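{- Let $S=\langle d_0,d_1,d_2,d_3\rangle$ be a numerical semigroup with embedding dimension four, and suppose the coefficients of the minimal relations $a_{ii}d_i=\sum_{j\ne i}a_{ij}d_j$ ($i=1,2,3$) are chosen such that at most one of $a_{10},a_{20},a_{30}$ equals $0$. Let $V$ be as in the context. If $(-\lambda_1,\lambda_2,\lambda_3)\in V$ satisfies $\lambda_0d_0+\lambda_1d_1=\lambda_2d_2+\lambda_3d_3$ with all $\lambda_i>0$ and $a_{00}>\lambda_0$, then every $(\mu_0,\mu_1,\mu_2,\mu_3)\in\mathbb N^4$ with $\sum\mu_id_i=\lambda_0d_0+\lambda_1d_1$ satisfies either $(\mu_0,\mu_1,\mu_2,\mu_3)=(0,0,\lambda_2,\lambda_3)$ or $\mu_2=\mu_3=0$.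
   Context: $S$ is the set of nonnegative integer combinations of its minimal generators $d_0,\dots,d_3$ ($\gcd=1$); $\mathrm{Ap}(S,d_0)=\{s\in S:s-d_0\notin S\}$. For $i\in\{0,1,2,3\}$, $a_{ii}$ is the least positive integer with $a_{ii}d_i=\sum_{j\ne i}a_{ij}d_j$ for some $a_{ij}\in\mathbb N$ (the $a_{ij}$ are fixed). Cubes $[[i,j,k]]$, $(i,j,k)\in\mathbb N^3$, are labeled $id_1+jd_2+kd_3$; the initial collection consists of all of them; deleting the region associated to $(a,b,c)\in\mathbb Z^3$ removes all cubes with $i\ge a,j\ge b,k\ge c$. $T$ is the set of cubes $[[i,j,k]]$ with label in $\mathrm{Ap}(S,d_0)$ and $i<a_{11}$, $j<a_{22}$, $k<a_{33}$. $V$ is a minimal set of points $(x,y,z)\in\mathbb Z^3$ with $xd_1+yd_2+zd_3$ a nonnegative multiple of $d_0$ such that deleting their associated regions from the initial collection leaves exactly $T$. -}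

module Defs where

open import Data.Nat using (ℕ; zero; suc; _+_; _*_; _≤_; _<_)
open import Data.Nat.GCD using (gcd)
open import Data.Fin using (Fin; zero; suc; _≟_)
open import Data.Integer as ℤ using (ℤ; +_)
open import Data.Product using (_×_; _,_; ∃; ∃-syntax; Σ-syntax)
open import Data.Sum using (_⊎_)
open import Data.Bool using (if_then_else_)
open import Relation.Nullary using (¬_)
open import Relation.Nullary.Decidable using (⌊_⌋)
open import Relation.Binary.PropositionalEquality using (_≡_; _≢_)

i0 i1 i2 i3 : Fin 4
i0 = zero
i1 = suc zero
i2 = suc (suc zero)
i3 = suc (suc (suc zero))

Σ4 : (Fin 4 → ℕ) → ℕ
Σ4 f = f i0 + f i1 + f i2 + f i3

ΣExcept : Fin 4 → (Fin 4 → ℕ) → ℕ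
ΣExcept i f = Σ4 (λ j → if ⌊ j ≟ i ⌋ then 0 else f j)

InS : (Fin 4 → ℕ) → ℕ → Set
InS d n = Σ[ c ∈ (Fin 4 → ℕ) ] Σ4 (λ j → c j * d j) ≡ n

InSWithout : (Fin 4 → ℕ) → Fin 4 → ℕ → Set
InSWithout d i n = Σ[ c ∈ (Fin 4 → ℕ) ] ΣExcept i (λ j → c j * d j) ≡ n

IsEmbDim4 : (Fin 4 → ℕ) → Set
IsEmbDim4 d =
  gcd (gcd (gcd (d i0) (d i1)) (d i2)) (d i3) ≡ 1
  × (∀ i → 0 < d i)
  × (∀ i → ¬ InSWithout d i (d i))

IsMinimalRelation : (Fin 4 → ℕ) → Fin 4 → (Fin 4 → ℕ) → Set
IsMinimalRelation d i ai =
  0 < ai i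
  × ai i * d i ≡ ΣExcept i (λ j → ai j * d j)
  × (∀ m → 0 < m → m < ai i → ¬ InSWithout d i (m * d i))

InApery : (Fin 4 → ℕ) → ℕ → Set
InApery d s = InS d s × ¬ (∃[ t ] (InS d t × t + d i0 ≡ s))

label : (Fin 4 → ℕ) → ℕ × ℕ × ℕ → ℕ
label d (i , j , k) = i * d i1 + j * d i2 + k * d i3

InT : (Fin 4 → ℕ) → (Fin 4 → Fin 4 → ℕ) → ℕ × ℕ × ℕ → Set
InT d a (i , j , k) =
  InApery d (label d (i , j , k))
  × i < a i1 i1 × j < a i2 i2 × k < a i3 i3

InRegion : ℤ × ℤ × ℤ → ℕ × ℕ × ℕ → Set
InRegion (x , y , z) (i , j , k) = x ℤ.≤ + i × y ℤ.≤ + j × z ℤ.≤ + k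

IsNonnegMultD0 : (Fin 4 → ℕ) → ℤ × ℤ × ℤ → Set
IsNonnegMultD0 d (x , y , z) =
  ∃[ m ] x ℤ.* + d i1 ℤ.+ y ℤ.* + d i2 ℤ.+ z ℤ.* + d i3 ≡ + (m * d i0)

-- a set W of points (as a predicate on ℤ³) is admissible: all its points
-- satisfy the multiple-of-d₀ condition, and deleting their regions from the
-- collection of all cubes leaves exactly T
Admissible : (Fin 4 → ℕ) → (Fin 4 → Fin 4 → ℕ) → (ℤ × ℤ × ℤ → Set) → Set
Admissible d a W =
  (∀ p → W p → IsNonnegMultD0 d p)
  × (∀ c → (InT d a c → ∀ p → W p → ¬ InRegion p c)
         × ((∀ p → W p → ¬ InRegion p c) → InT d a c))

IsV : (Fin 4 → ℕ) → (Fin 4 → Fin 4 → ℕ) → (ℤ × ℤ × ℤ → Set) → Set₁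
IsV d a V =
  Admissible d a V
  × (∀ (W : ℤ × ℤ × ℤ → Set) → (∀ p → W p → V p) → Admissible d a W
       → ∀ p → V p → W p)

-- Put N = λ₀d₀ + λ₁d₁ = λ₂d₂ + λ₃d₃ and p = (x, λ₂, λ₃) ∈ V. Since V is minimal,
-- p is not redundant: the cubes [[i, λ₂−1, k]] with k ≥ λ₃ cannot all lie
-- outside T, nor can the cubes [[i, j, λ₃−1]] with j ≥ λ₂. Hence N − d₀ − d₂ ∉ S
-- and N − d₀ − d₃ ∉ S (else those cubes are not in Ap(S,d₀)), and λ₃ < a₃₃,
-- λ₂ < a₂₂ (else they leave the box). So a representation μ of N with μ₀ > 0 has
-- μ₂ = μ₃ = 0. If μ₀ = 0, then μ₂ ≤ λ₂ and μ₃ ≤ λ₃ (an excess in d₂ writes some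
-- g d₃ with 0 < g ≤ λ₃ without d₃, forcing a₃₃ ≤ λ₃), and μ₁ ≤ λ₁ because
-- λ₀ < a₀₀. Subtracting μ from the sum of the two λ-representations gives
-- N = λ₀d₀ + (λ₁−μ₁)d₁ + (λ₂−μ₂)d₂ + (λ₃−μ₃)d₃, which involves d₀; so μ₂ = λ₂,
-- μ₃ = λ₃, and finally μ₁ = 0.

module Submission where

open import Defs
open import Data.Fin using (Fin)
open import Data.Nat using (ℕ; _+_; _*_; _<_)
open import Data.Integer using (ℤ; +_; -_)
open import Data.Product using (_×_; _,_)
open import Data.Sum using (_⊎_)
open import Relation.Nullary using (¬_)
open import Relation.Binary.PropositionalEquality using (_≡_)

open import Data.Nat using (zero; suc; _∸_; _≤_; s≤s; z<s; _<?_; _≤?_)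
open import Data.Nat.Properties
open import Data.Nat.Tactic.RingSolver using (solve)
import Data.Integer.Properties as ℤ
open import Data.Integer using (+≤+)
open import Data.List using ([]; _∷_)
open import Algebra.Properties.CommutativeSemigroup +-commutativeSemigroup using (xy∙z≈xz∙y)
import Data.Vec.Functional as Vector
open import Data.Product using (proj₁; proj₂; ∃-syntax)
open import Data.Sum using (inj₁; inj₂)
open import Data.Empty using (⊥-elim)
open import Relation.Nullary using (yes; no)
open import Function using (_∘_)
open import Relation.Binary.PropositionalEquality using (_≢_; refl; sym; trans; cong; cong₂; module ≡-Reasoning)

open ≡-Reasoning

excess-exchange : ∀ P B C l m k n → 0 < B → P + m * B + n * C ≡ l * B + k * C → l < m
  → ∃[ g ] ∃[ e ] 0 < g × g ≤ k × P + e * B ≡ g * C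
excess-exchange P B C l m k n _ eq l<m with m≤n⇒∃[o]m+o≡n l<m | n <? k
... | e , refl | yes n<k with m≤n⇒∃[o]m+o≡n n<k
...   | g , refl = suc g , suc e , z<s , s≤s (m≤n+m g n) , +-cancelˡ-≡ (l * B + n * C) _ _ (begin
  l * B + n * C + (P + suc e * B)  ≡⟨ solve (P ∷ B ∷ C ∷ l ∷ e ∷ n ∷ []) ⟩
  P + (suc l + e) * B + n * C      ≡⟨ eq ⟩
  l * B + (suc n + g) * C          ≡⟨ solve (B ∷ C ∷ l ∷ n ∷ g ∷ []) ⟩
  l * B + n * C + suc g * C        ∎)
excess-exchange P (suc B) C l m k n _ eq l<m | e , refl | no n≮k with m≤n⇒∃[o]m+o≡n (≮⇒≥ n≮k)
...   | h , refl = ⊥-elim (m+1+n≢m (l * suc B + k * C) (begin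
  l * suc B + k * C + suc (B + P + e * suc B + h * C)  ≡⟨ solve (P ∷ B ∷ C ∷ l ∷ e ∷ k ∷ h ∷ []) ⟩
  P + (suc l + e) * suc B + (k + h) * C               ≡⟨ eq ⟩
  l * suc B + k * C                                   ∎))

cancel-common-d₁ : ∀ {D0 D1 D2 D3} l0 l1 m1 m2 m3 → l1 ≤ m1
  → m1 * D1 + m2 * D2 + m3 * D3 ≡ l0 * D0 + l1 * D1
  → (m1 ∸ l1) * D1 + m2 * D2 + m3 * D3 ≡ l0 * D0
cancel-common-d₁ {D0} {D1} {D2} {D3} l0 l1 m1 m2 m3 l1≤m1 eq with m≤n⇒∃[o]m+o≡n l1≤m1
... | e , refl rewrite m+n∸m≡n l1 e = +-cancelʳ-≡ (l1 * D1) _ _ (begin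
  e * D1 + m2 * D2 + m3 * D3 + l1 * D1  ≡⟨ solve (D1 ∷ D2 ∷ D3 ∷ l1 ∷ e ∷ m2 ∷ m3 ∷ []) ⟩
  (l1 + e) * D1 + m2 * D2 + m3 * D3    ≡⟨ eq ⟩
  l0 * D0 + l1 * D1                    ∎)

complementary-representation : ∀ {D0 D1 D2 D3} l0 l1 l2 l3 m1 m2 m3 → m1 ≤ l1 → m2 ≤ l2 → m3 ≤ l3
  → m1 * D1 + m2 * D2 + m3 * D3 ≡ l0 * D0 + l1 * D1
  → l2 * D2 + l3 * D3 ≡ l0 * D0 + (l1 ∸ m1) * D1 + (l2 ∸ m2) * D2 + (l3 ∸ m3) * D3
complementary-representation {D0} {D1} {D2} {D3} l0 l1 l2 l3 m1 m2 m3 m1≤l1 m2≤l2 m3≤l3 eq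
  with m≤n⇒∃[o]m+o≡n m1≤l1 | m≤n⇒∃[o]m+o≡n m2≤l2 | m≤n⇒∃[o]m+o≡n m3≤l3
... | e1 , refl | e2 , refl | e3 , refl
  rewrite m+n∸m≡n m1 e1 | m+n∸m≡n m2 e2 | m+n∸m≡n m3 e3 =
  +-cancelˡ-≡ (m1 * D1 + m2 * D2 + m3 * D3) _ _ (begin
    m1 * D1 + m2 * D2 + m3 * D3 + ((m2 + e2) * D2 + (m3 + e3) * D3)
      ≡⟨ cong (_+ ((m2 + e2) * D2 + (m3 + e3) * D3)) eq ⟩
    l0 * D0 + (m1 + e1) * D1 + ((m2 + e2) * D2 + (m3 + e3) * D3)
      ≡⟨ solve (D0 ∷ D1 ∷ D2 ∷ D3 ∷ l0 ∷ m1 ∷ m2 ∷ m3 ∷ e1 ∷ e2 ∷ e3 ∷ []) ⟩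
    m1 * D1 + m2 * D2 + m3 * D3 + (l0 * D0 + e1 * D1 + e2 * D2 + e3 * D3) ∎)

d₀-splits-off-layer₂ : ∀ {D0 D1 D2 D3} y z c0 c1 c2 c3 i k
  → suc y * D2 + z * D3 ≡ suc c0 * D0 + c1 * D1 + suc c2 * D2 + c3 * D3
  → c0 * D0 + (c1 + i) * D1 + c2 * D2 + (c3 + k) * D3 + D0 ≡ i * D1 + y * D2 + (z + k) * D3
d₀-splits-off-layer₂ {D0} {D1} {D2} {D3} y z c0 c1 c2 c3 i k eq = +-cancelʳ-≡ D2 _ _ (begin
  c0 * D0 + (c1 + i) * D1 + c2 * D2 + (c3 + k) * D3 + D0 + D2
    ≡⟨ solve (D0 ∷ D1 ∷ D2 ∷ D3 ∷ c0 ∷ c1 ∷ c2 ∷ c3 ∷ i ∷ k ∷ []) ⟩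
  suc c0 * D0 + c1 * D1 + suc c2 * D2 + c3 * D3 + (i * D1 + k * D3)
    ≡⟨ cong (_+ (i * D1 + k * D3)) (sym eq) ⟩
  suc y * D2 + z * D3 + (i * D1 + k * D3)
    ≡⟨ solve (D1 ∷ D2 ∷ D3 ∷ y ∷ z ∷ i ∷ k ∷ []) ⟩
  i * D1 + y * D2 + (z + k) * D3 + D2 ∎)

d₀-splits-off-layer₃ : ∀ {D0 D1 D2 D3} y z c0 c1 c2 c3 i j
  → y * D2 + suc z * D3 ≡ suc c0 * D0 + c1 * D1 + c2 * D2 + suc c3 * D3
  → c0 * D0 + (c1 + i) * D1 + (c2 + j) * D2 + c3 * D3 + D0 ≡ i * D1 + (y + j) * D2 + z * D3
d₀-splits-off-layer₃ {D0} {D1} {D2} {D3} y z c0 c1 c2 c3 i j eq = +-cancelʳ-≡ D3 _ _ (begin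
  c0 * D0 + (c1 + i) * D1 + (c2 + j) * D2 + c3 * D3 + D0 + D3
    ≡⟨ solve (D0 ∷ D1 ∷ D2 ∷ D3 ∷ c0 ∷ c1 ∷ c2 ∷ c3 ∷ i ∷ j ∷ []) ⟩
  suc c0 * D0 + c1 * D1 + c2 * D2 + suc c3 * D3 + (i * D1 + j * D2)
    ≡⟨ cong (_+ (i * D1 + j * D2)) (sym eq) ⟩
  y * D2 + suc z * D3 + (i * D1 + j * D2)
    ≡⟨ solve (D1 ∷ D2 ∷ D3 ∷ y ∷ z ∷ i ∷ j ∷ []) ⟩
  i * D1 + (y + j) * D2 + z * D3 + D3 ∎)

coefficients : ℕ → ℕ → ℕ → ℕ → Fin 4 → ℕ
coefficients c0 c1 c2 c3 = c0 Vector.∷ c1 Vector.∷ c2 Vector.∷ c3 Vector.∷ Vector.[]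

_≤³_ : ℕ × ℕ × ℕ → ℕ × ℕ × ℕ → Set
(i , j , k) ≤³ (i′ , j′ , k′) = i ≤ i′ × j ≤ j′ × k ≤ k′

InRegion-mono : ∀ p {c c′} → c ≤³ c′ → InRegion p c → InRegion p c′
InRegion-mono (_ , _ , _) (i≤ , j≤ , k≤) (x≤ , y≤ , z≤) =
  ℤ.≤-trans x≤ (+≤+ i≤) , ℤ.≤-trans y≤ (+≤+ j≤) , ℤ.≤-trans z≤ (+≤+ k≤)

module Labels (d : Fin 4 → ℕ) (a : Fin 4 → Fin 4 → ℕ) where

  ⟨_,_,_,_⟩ : ℕ → ℕ → ℕ → ℕ → ℕ
  ⟨ c0 , c1 , c2 , c3 ⟩ = c0 * d i0 + c1 * d i1 + c2 * d i2 + c3 * d i3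

  label-d₀∈S⇒∉T : ∀ c0 c1 c2 c3 c → ⟨ c0 , c1 , c2 , c3 ⟩ + d i0 ≡ label d c → ¬ InT d a c
  label-d₀∈S⇒∉T c0 c1 c2 c3 c eq ((_ , not-shifted) , _) =
    not-shifted (_ , (coefficients c0 c1 c2 c3 , refl) , eq)

module Deletion (d : Fin 4 → ℕ) (a : Fin 4 → Fin 4 → ℕ) (V : ℤ × ℤ × ℤ → Set) (V-min : IsV d a V) where

  -- Otherwise V without p would still be admissible.
  irredundant : ∀ {p} → V p
    → ¬ (∀ c → InRegion p c → ∃[ c′ ] c′ ≤³ c × ¬ InRegion p c′ × ¬ InT d a c′)
  irredundant {p} p∈V retract = proj₂ (proj₂ V-min W (λ _ → proj₁) W-admissible p p∈V) refl
    where
    admissible : Admissible d a V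
    admissible = proj₁ V-min
    W : ℤ × ℤ × ℤ → Set
    W q = V q × q ≢ p
    undeleted : ∀ c → (∀ q → W q → ¬ InRegion q c) → ∀ q → V q → ¬ InRegion q c
    undeleted c free q q∈V q∋c = free q (q∈V , q≢p) q∋c
      where
      q≢p : q ≢ p
      q≢p refl with retract c q∋c
      ... | c′ , c′≤c , p∌c′ , c′∉T = c′∉T (proj₂ (proj₂ admissible c′) λ q′ q′∈V q′∋c′ →
              free q′ (q′∈V , λ { refl → p∌c′ q′∋c′ }) (InRegion-mono q′ c′≤c q′∋c′))
    W-admissible : Admissible d a W
    W-admissible = (λ q → proj₁ admissible q ∘ proj₁)
                 , λ c → (λ c∈T q → proj₁ (proj₂ admissible c) c∈T q ∘ proj₁)
                       , (λ free → proj₂ (proj₂ admissible c) (undeleted c free))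

  irredundant₂ : ∀ {x y z} → V (x , + suc y , + z) → ¬ (∀ i k → z ≤ k → ¬ InT d a (i , y , k))
  irredundant₂ {y = y} p∈V layer∉T = irredundant p∈V retract
    where
    retract : ∀ c → InRegion _ c → ∃[ c′ ] c′ ≤³ c × ¬ InRegion _ c′ × ¬ InT d a c′
    retract (i , j , k) (_ , +≤+ y<j , +≤+ z≤k) =
      (i , y , k) , (≤-refl , <⇒≤ y<j , ≤-refl)
      , (λ { (_ , +≤+ y<y , _) → <-irrefl refl y<y }) , layer∉T i k z≤k

  irredundant₃ : ∀ {x y z} → V (x , + y , + suc z) → ¬ (∀ i j → y ≤ j → ¬ InT d a (i , j , z))
  irredundant₃ {z = z} p∈V layer∉T = irredundant p∈V retract
    where
    retract : ∀ c → InRegion _ c → ∃[ c′ ] c′ ≤³ c × ¬ InRegion _ c′ × ¬ InT d a c′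
    retract (i , j , k) (_ , +≤+ y≤j , +≤+ z<k) =
      (i , j , z) , (≤-refl , ≤-refl , <⇒≤ z<k)
      , (λ { (_ , _ , +≤+ z<z) → <-irrefl refl z<z }) , layer∉T i j y≤j

-- The point is (x, λ₂, λ₃) with λ₂ = suc y and λ₃ = suc z.
module Point (d : Fin 4 → ℕ) (a : Fin 4 → Fin 4 → ℕ) (V : ℤ × ℤ × ℤ → Set) (V-min : IsV d a V)
             (relations : ∀ i → IsMinimalRelation d i (a i)) (d>0 : ∀ i → 0 < d i)
             {x : ℤ} {y z : ℕ} (p∈V : V (x , + suc y , + suc z)) where

  open Labels d a
  open Deletion d a V V-min

  N : ℕ
  N = suc y * d i2 + suc z * d i3

  aᵢᵢ-least : ∀ i m → 0 < m → InSWithout d i (m * d i) → a i i ≤ m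
  aᵢᵢ-least i m 0<m m∈S = ≮⇒≥ λ m<aᵢᵢ → proj₂ (proj₂ (relations i)) m 0<m m<aᵢᵢ m∈S

  λ₃<a₃₃ : suc z < a i3 i3
  λ₃<a₃₃ = ≰⇒> λ a₃₃≤λ₃ → irredundant₂ p∈V λ i k λ₃≤k (_ , _ , _ , k<a₃₃) →
    <⇒≱ k<a₃₃ (≤-trans a₃₃≤λ₃ λ₃≤k)

  λ₂<a₂₂ : suc y < a i2 i2
  λ₂<a₂₂ = ≰⇒> λ a₂₂≤λ₂ → irredundant₃ p∈V λ i j λ₂≤j (_ , _ , j<a₂₂ , _) →
    <⇒≱ j<a₂₂ (≤-trans a₂₂≤λ₂ λ₂≤j)

  N-d₀-d₂∉S : ∀ c0 c1 c2 c3 → N ≢ ⟨ suc c0 , c1 , suc c2 , c3 ⟩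
  N-d₀-d₂∉S c0 c1 c2 c3 eq = irredundant₂ p∈V layer∉T
    where
    layer∉T : ∀ i k → suc z ≤ k → ¬ InT d a (i , y , k)
    layer∉T i k λ₃≤k with m≤n⇒∃[o]m+o≡n λ₃≤k
    ... | k′ , refl = label-d₀∈S⇒∉T c0 (c1 + i) c2 (c3 + k′) (i , y , suc z + k′)
                        (d₀-splits-off-layer₂ y (suc z) c0 c1 c2 c3 i k′ eq)

  N-d₀-d₃∉S : ∀ c0 c1 c2 c3 → N ≢ ⟨ suc c0 , c1 , c2 , suc c3 ⟩
  N-d₀-d₃∉S c0 c1 c2 c3 eq = irredundant₃ p∈V layer∉T
    where
    layer∉T : ∀ i j → suc y ≤ j → ¬ InT d a (i , j , z)
    layer∉T i j λ₂≤j with m≤n⇒∃[o]m+o≡n λ₂≤j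
    ... | j′ , refl = label-d₀∈S⇒∉T c0 (c1 + i) (c2 + j′) c3 (i , suc y + j′ , z)
                        (d₀-splits-off-layer₃ (suc y) z c0 c1 c2 c3 i j′ eq)

  representation-with-d₀ : ∀ c0 c1 c2 c3 → ⟨ suc c0 , c1 , c2 , c3 ⟩ ≡ N → c2 ≡ 0 × c3 ≡ 0
  representation-with-d₀ c0 c1 zero     zero     _  = refl , refl
  representation-with-d₀ c0 c1 (suc c2) c3       eq = ⊥-elim (N-d₀-d₂∉S c0 c1 c2 c3 (sym eq))
  representation-with-d₀ c0 c1 zero     (suc c3) eq = ⊥-elim (N-d₀-d₃∉S c0 c1 zero c3 (sym eq))

  representation-bound₂ : ∀ c0 c1 c2 c3 → ⟨ c0 , c1 , c2 , c3 ⟩ ≡ N → c2 ≤ suc y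
  representation-bound₂ c0 c1 c2 c3 eq with c2 ≤? suc y
  ... | yes c2≤λ₂ = c2≤λ₂
  ... | no c2≰λ₂
    with excess-exchange (c0 * d i0 + c1 * d i1) (d i2) (d i3) (suc y) c2 (suc z) c3 (d>0 i2) eq (≰⇒> c2≰λ₂)
  ...   | g , e , 0<g , g≤λ₃ , gd₃∈S = ⊥-elim (<⇒≱ λ₃<a₃₃ (≤-trans a₃₃≤g g≤λ₃))
    where
    a₃₃≤g : a i3 i3 ≤ g
    a₃₃≤g = aᵢᵢ-least i3 g 0<g (coefficients c0 c1 e 0 , trans (+-identityʳ _) gd₃∈S)

  representation-bound₃ : ∀ c0 c1 c2 c3 → ⟨ c0 , c1 , c2 , c3 ⟩ ≡ N → c3 ≤ suc z
  representation-bound₃ c0 c1 c2 c3 eq with c3 ≤? suc z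
  ... | yes c3≤λ₃ = c3≤λ₃
  ... | no c3≰λ₃
    with excess-exchange (c0 * d i0 + c1 * d i1) (d i3) (d i2) (suc z) c3 (suc y) c2 (d>0 i3)
           (trans (xy∙z≈xz∙y (c0 * d i0 + c1 * d i1) _ _) (trans eq (+-comm (suc y * d i2) _))) (≰⇒> c3≰λ₃)
  ...   | g , e , 0<g , g≤λ₂ , gd₂∈S = ⊥-elim (<⇒≱ λ₂<a₂₂ (≤-trans a₂₂≤g g≤λ₂))
    where
    a₂₂≤g : a i2 i2 ≤ g
    a₂₂≤g = aᵢᵢ-least i2 g 0<g
              (coefficients c0 c1 0 e , trans (cong (_+ e * d i3) (+-identityʳ _)) gd₂∈S)

  representation-without-d₀ : ∀ {l₀} λ₁ μ₁ μ₂ μ₃ → suc l₀ < a i0 i0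
    → suc l₀ * d i0 + λ₁ * d i1 ≡ N
    → ⟨ 0 , μ₁ , μ₂ , μ₃ ⟩ ≡ suc l₀ * d i0 + λ₁ * d i1
    → μ₁ ≡ 0 × μ₂ ≡ suc y × μ₃ ≡ suc z
  representation-without-d₀ {l₀} λ₁ μ₁ μ₂ μ₃ λ₀<a₀₀ rel eq with ≤-total λ₁ μ₁
  ... | inj₁ λ₁≤μ₁ = ⊥-elim (<⇒≱ λ₀<a₀₀ (aᵢᵢ-least i0 (suc l₀) z<s
          (coefficients 0 (μ₁ ∸ λ₁) μ₂ μ₃ , cancel-common-d₁ (suc l₀) λ₁ μ₁ μ₂ μ₃ λ₁≤μ₁ eq)))
  ... | inj₂ μ₁≤λ₁ = μ₁≡0 , μ₂≡λ₂ , μ₃≡λ₃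
    where
    μ₂≤λ₂ : μ₂ ≤ suc y
    μ₂≤λ₂ = representation-bound₂ 0 μ₁ μ₂ μ₃ (trans eq rel)
    μ₃≤λ₃ : μ₃ ≤ suc z
    μ₃≤λ₃ = representation-bound₃ 0 μ₁ μ₂ μ₃ (trans eq rel)
    differences-vanish : suc y ∸ μ₂ ≡ 0 × suc z ∸ μ₃ ≡ 0
    differences-vanish = representation-with-d₀ l₀ (λ₁ ∸ μ₁) (suc y ∸ μ₂) (suc z ∸ μ₃)
      (sym (complementary-representation (suc l₀) λ₁ (suc y) (suc z) μ₁ μ₂ μ₃ μ₁≤λ₁ μ₂≤λ₂ μ₃≤λ₃ eq))
    μ₂≡λ₂ : μ₂ ≡ suc y
    μ₂≡λ₂ = ≤-antisym μ₂≤λ₂ (m∸n≡0⇒m≤n (proj₁ differences-vanish))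
    μ₃≡λ₃ : μ₃ ≡ suc z
    μ₃≡λ₃ = ≤-antisym μ₃≤λ₃ (m∸n≡0⇒m≤n (proj₂ differences-vanish))
    μ₁d₁+N≡N : μ₁ * d i1 + N ≡ 0 + N
    μ₁d₁+N≡N = begin
      μ₁ * d i1 + N                          ≡⟨ +-assoc (μ₁ * d i1) _ _ ⟨
      ⟨ 0 , μ₁ , suc y , suc z ⟩             ≡⟨ cong₂ (λ u v → ⟨ 0 , μ₁ , u , v ⟩) μ₂≡λ₂ μ₃≡λ₃ ⟨
      ⟨ 0 , μ₁ , μ₂ , μ₃ ⟩                   ≡⟨ trans eq rel ⟩
      N                                      ∎
    μ₁≡0 : μ₁ ≡ 0
    μ₁≡0 with m*n≡0⇒m≡0∨n≡0 μ₁ (+-cancelʳ-≡ N _ _ μ₁d₁+N≡N)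
    ... | inj₁ μ₁≡0 = μ₁≡0
    ... | inj₂ d₁≡0 = ⊥-elim (<⇒≢ (d>0 i1) (sym d₁≡0))

-- The hypotheses on a₁₀, a₂₀, a₃₀ and 0 < λ₁, and the first coordinate of the
-- point of V, are not needed.
lemma3p7 : (d : Fin 4 → ℕ) (a : Fin 4 → Fin 4 → ℕ)
    → IsEmbDim4 d
    → (∀ i → IsMinimalRelation d i (a i))
    → ¬ (a i1 i0 ≡ 0 × a i2 i0 ≡ 0)
    → ¬ (a i1 i0 ≡ 0 × a i3 i0 ≡ 0)
    → ¬ (a i2 i0 ≡ 0 × a i3 i0 ≡ 0)
    → (V : ℤ × ℤ × ℤ → Set) → IsV d a V
    → (λ₀ λ₁ λ₂ λ₃ : ℕ)
    → V (- (+ λ₁) , + λ₂ , + λ₃)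
    → λ₀ * d i0 + λ₁ * d i1 ≡ λ₂ * d i2 + λ₃ * d i3
    → 0 < λ₀ → 0 < λ₁ → 0 < λ₂ → 0 < λ₃
    → λ₀ < a i0 i0
    → (μ₀ μ₁ μ₂ μ₃ : ℕ)
    → μ₀ * d i0 + μ₁ * d i1 + μ₂ * d i2 + μ₃ * d i3 ≡ λ₀ * d i0 + λ₁ * d i1
    → (μ₀ ≡ 0 × μ₁ ≡ 0 × μ₂ ≡ λ₂ × μ₃ ≡ λ₃) ⊎ (μ₂ ≡ 0 × μ₃ ≡ 0)
lemma3p7 d a (_ , d>0 , _) relations _ _ _ V V-min λ₀ λ₁ λ₂ λ₃ p∈V rel
         z<s _ z<s z<s λ₀<a₀₀ μ₀ μ₁ μ₂ μ₃ eq = by-d₀-coefficient μ₀ eq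
  where
  open Point d a V V-min relations d>0 p∈V
  by-d₀-coefficient : ∀ μ₀ → μ₀ * d i0 + μ₁ * d i1 + μ₂ * d i2 + μ₃ * d i3 ≡ λ₀ * d i0 + λ₁ * d i1
    → (μ₀ ≡ 0 × μ₁ ≡ 0 × μ₂ ≡ λ₂ × μ₃ ≡ λ₃) ⊎ (μ₂ ≡ 0 × μ₃ ≡ 0)
  by-d₀-coefficient zero    eq = inj₁ (refl , representation-without-d₀ λ₁ μ₁ μ₂ μ₃ λ₀<a₀₀ rel eq)
  by-d₀-coefficient (suc c₀) eq = inj₂ (representation-with-d₀ c₀ μ₁ μ₂ μ₃ (trans eq rel))
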